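{- For every $n\times n$ alternating matrix $\Omega$ of quadratic forms in $x_1,\ldots,x_n$ over $K$ and every $g \in \mathrm{GL}_n(K)$ we have $c_4(g\star\Omega) = c_4(\Omega)$ and $c_6(g\star\Omega) = c_6(\Omega)$.
   Context: $K$ is a field of characteristic $0$, $n\ge 3$. For $g\in\mathrm{GL}_n$, $g\star\Omega = g^{ -T}\big(\Omega(\sum_i g_{i1}x_i,\ldots,\sum_i g_{in}x_i)\big) g^{ -1}$, where $g^{ -T}$ is the inverse transpose. Put $M_{ij} = \sum_{r,s=1}^n \frac{\partial \Omega_{ir}}{\partial x_s}\frac{\partial \Omega_{js}}{\partial x_r}$, $N_{ijk} = \sum_{r=1}^n \frac{\partial M_{ij}}{\partial x_r}\Omega_{rk}$, \[ c_4(\Omega) = \frac{3(n-2)^2}{2^4 n \binom{n+3}{5}} \sum_{i,j,r,s=1}^n \frac{\partial^2 M_{ij}}{\partial x_r \partial x_s}\frac{\partial^2 M_{rs}}{\partial x_i\partial x_j}, \qquad c_6(\Omega) = \frac{ -(n-2)^3}{2^6 n\binom{n+5}{7}} \sum_{i,j,k,r,s,t=1}^n \frac{\partial^3 N_{ijk}}{\partial x_r\partial x_s\partial x_t}\frac{\partial^3 N_{rst}}{\partial x_i\partial x_j\partial x_k}. \] -}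

module Defs where

open import Level using (Level; _⊔_) renaming (suc to lsuc)
open import Algebra.Bundles using (CommutativeRing)
open import Relation.Nullary using (¬_; yes; no)
open import Relation.Binary.PropositionalEquality using (_≡_; refl; sym; trans; subst)
open import Data.Nat as ℕ using (ℕ; zero; suc; _≤_; _<_; z≤n; s≤s; NonZero; _∸_; _^_)
open import Data.Nat.Properties using (≤-trans; m≤m+n; m*n≢0; +-monoˡ-≤)
open import Data.Nat.Base using (>-nonZero)
open import Data.Nat.Combinatorics using (_C_; nCk+nC[k+1]≡[n+1]C[k+1]; nCk≡nC[n∸k]; nCn≡1)
open import Data.Fin using (Fin; zero; suc) renaming (_≟_ to _≟ᶠ_)
open import Data.Product using (Σ; _×_; _,_; proj₁)

record Field (c ℓ : Level) : Set (lsuc (c ⊔ ℓ)) where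
  field
    commutativeRing : CommutativeRing c ℓ
  open CommutativeRing commutativeRing public
  field
    0≉1     : ¬ (0# ≈ 1#)
    inv     : (x : Carrier) → ¬ (x ≈ 0#) → Carrier
    inverse : (x : Carrier) (p : ¬ (x ≈ 0#)) → x * inv x p ≈ 1#

C-pos : ∀ a b → b ≤ a → 0 < a C b
C-pos a zero _ = subst (0 <_) (sym (trans (nCk≡nC[n∸k] {0} {a} z≤n) (nCn≡1 a))) (s≤s z≤n)
C-pos (suc a) (suc b) (s≤s b≤a) =
  ≤-trans (C-pos a b b≤a) (subst (a C b ≤_) (nCk+nC[k+1]≡[n+1]C[k+1] a b) (m≤m+n _ _))

module _ {c ℓ : Level} (F : Field c ℓ) where
  open Field F using (Carrier; _≈_; _+_; _*_; -_; 0#; 1#; inv)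

  ⟦_⟧ : ℕ → Carrier
  ⟦ zero ⟧  = 0#
  ⟦ suc m ⟧ = 1# + ⟦ m ⟧

  CharZero : Set ℓ
  CharZero = (m : ℕ) → ¬ (⟦ suc m ⟧ ≈ 0#)

  ΣK : ∀ {n} → (Fin n → Carrier) → Carrier
  ΣK {zero}  f = 0#
  ΣK {suc n} f = f zero + ΣK (λ i → f (suc i))

  Mat : ℕ → Set c
  Mat n = Fin n → Fin n → Carrier

  δ : ∀ {n} → Fin n → Fin n → Carrier
  δ i j with i ≟ᶠ j
  ... | yes _ = 1#
  ... | no  _ = 0#

  _·_ : ∀ {n} → Mat n → Mat n → Mat n
  (A · B) i j = ΣK (λ k → A i k * B k j)

  IsInverse : ∀ {n} → Mat n → Mat n → Set ℓ
  IsInverse g h = (∀ i j → (g · h) i j ≈ δ i j) × (∀ i j → (h · g) i j ≈ δ i j)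

  GL : ℕ → Set (c ⊔ ℓ)
  GL n = Σ (Mat n) λ g → Σ (Mat n) λ h → IsInverse g h

  infixl 6 _⊕_
  infixl 7 _⊗_
  data Poly (n : ℕ) : Set c where
    con : Carrier → Poly n
    var : Fin n → Poly n
    _⊕_ : Poly n → Poly n → Poly n
    _⊗_ : Poly n → Poly n → Poly n
    ⊝_  : Poly n → Poly n

  eval : ∀ {n} → Poly n → (Fin n → Carrier) → Carrier
  eval (con a)   x = a
  eval (var i)   x = x i
  eval (p ⊕ q)   x = eval p x + eval q x
  eval (p ⊗ q)   x = eval p x * eval q x
  eval (⊝ p)     x = - eval p x

  ∂ : ∀ {n} → Fin n → Poly n → Poly n
  ∂ i (con a) = con 0#
  ∂ i (var j) = con (δ i j)
  ∂ i (p ⊕ q) = ∂ i p ⊕ ∂ i q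
  ∂ i (p ⊗ q) = ∂ i p ⊗ q ⊕ p ⊗ ∂ i q
  ∂ i (⊝ p)   = ⊝ ∂ i p

  subst-vars : ∀ {n} → (Fin n → Poly n) → Poly n → Poly n
  subst-vars σ (con a) = con a
  subst-vars σ (var j) = σ j
  subst-vars σ (p ⊕ q) = subst-vars σ p ⊕ subst-vars σ q
  subst-vars σ (p ⊗ q) = subst-vars σ p ⊗ subst-vars σ q
  subst-vars σ (⊝ p)   = ⊝ subst-vars σ p

  ΣP : ∀ {n m} → (Fin m → Poly n) → Poly n
  ΣP {m = zero}  f = con 0#
  ΣP {m = suc m} f = f zero ⊕ ΣP (λ i → f (suc i))

  _≐_ : ∀ {n} → Poly n → Poly n → Set (c ⊔ ℓ)
  p ≐ q = ∀ x → eval p x ≈ eval q x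

  -- A quadratic form in x_1..x_n is
  -- Σ_{a,b} q_ab x_a x_b for a coefficient array q; an n×n matrix of
  -- quadratic forms is given by Q : Fin n → Fin n → (Fin n → Fin n → K).

  QCoeffs : ℕ → Set c
  QCoeffs n = Fin n → Fin n → Mat n

  quadForm : ∀ {n} → Mat n → Poly n
  quadForm q = ΣP λ a → ΣP λ b → con (q a b) ⊗ var a ⊗ var b

  PolyMat : ℕ → Set c
  PolyMat n = Fin n → Fin n → Poly n

  Ωof : ∀ {n} → QCoeffs n → PolyMat n
  Ωof Q i j = quadForm (Q i j)

  -- equality of quadratic forms as polynomials: equal coefficients of
  -- every monomial x_a x_b, i.e. equal symmetrised coefficient arrays
  _≡Q_ : ∀ {n} → Mat n → Mat n → Set ℓ
  q ≡Q q' = ∀ a b → q a b + q b a ≈ q' a b + q' b a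

  IsAlternating : ∀ {n} → QCoeffs n → Set ℓ
  IsAlternating Q = (∀ i → Q i i ≡Q (λ _ _ → 0#))
                  × (∀ i j → Q j i ≡Q (λ a b → - Q i j a b))

  -- The action g ⋆ Ω = g^{-T} Ω(Σ_i g_{i1} x_i, …, Σ_i g_{in} x_i) g^{-1}

  _⋆_ : ∀ {n} → GL n → PolyMat n → PolyMat n
  ((g , h , _) ⋆ Ω) i j =
    ΣP λ a → ΣP λ b →
      con (h a i) ⊗ subst-vars (λ k → ΣP λ l → con (g l k) ⊗ var l) (Ω a b) ⊗ con (h b j)

  module _ (char0 : CharZero) where

    invNat : (m : ℕ) → .{{NonZero m}} → Carrier
    invNat (suc m) = inv ⟦ suc m ⟧ (char0 m)

    module _ {n : ℕ} (n≥3 : 3 ≤ n) where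

      private
        nz-n : NonZero n
        nz-n = >-nonZero (≤-trans (s≤s z≤n) n≥3)
        nz-C4 : NonZero ((n ℕ.+ 3) C 5)
        nz-C4 = >-nonZero (C-pos (n ℕ.+ 3) 5 (≤-trans (s≤s (s≤s (s≤s (s≤s (s≤s z≤n))))) (+-monoˡ-≤ 3 n≥3)))
        nz-C6 : NonZero ((n ℕ.+ 5) C 7)
        nz-C6 = >-nonZero (C-pos (n ℕ.+ 5) 7 (≤-trans (s≤s (s≤s (s≤s (s≤s (s≤s (s≤s (s≤s z≤n))))))) (+-monoˡ-≤ 5 n≥3)))

      d₄ d₆ : ℕ
      d₄ = 2 ^ 4 ℕ.* n ℕ.* ((n ℕ.+ 3) C 5)
      d₆ = 2 ^ 6 ℕ.* n ℕ.* ((n ℕ.+ 5) C 7)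

      inv-d₄ inv-d₆ : Carrier
      inv-d₄ = invNat d₄ {{m*n≢0 (2 ^ 4 ℕ.* n) _ {{m*n≢0 (2 ^ 4) n {{_}} {{nz-n}}}} {{nz-C4}}}}
      inv-d₆ = invNat d₆ {{m*n≢0 (2 ^ 6 ℕ.* n) _ {{m*n≢0 (2 ^ 6) n {{_}} {{nz-n}}}} {{nz-C6}}}}

      module _ (Ω : PolyMat n) where
        M : PolyMat n
        M i j = ΣP λ r → ΣP λ s → ∂ s (Ω i r) ⊗ ∂ r (Ω j s)

        N : Fin n → Fin n → Fin n → Poly n
        N i j k = ΣP λ r → ∂ r (M i j) ⊗ Ω r k

        c₄ : Poly n
        c₄ = con (⟦ 3 ℕ.* (n ∸ 2) ^ 2 ⟧ * inv-d₄) ⊗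
               (ΣP λ i → ΣP λ j → ΣP λ r → ΣP λ s →
                  ∂ s (∂ r (M i j)) ⊗ ∂ j (∂ i (M r s)))

        c₆ : Poly n
        c₆ = con (- (⟦ (n ∸ 2) ^ 3 ⟧ * inv-d₆)) ⊗
               (ΣP λ i → ΣP λ j → ΣP λ k → ΣP λ r → ΣP λ s → ΣP λ t →
                  ∂ t (∂ s (∂ r (N i j k))) ⊗ ∂ k (∂ j (∂ i (N r s t))))

module Submission where

open import Defs
open import Level using (Level)
open import Data.Nat using (ℕ; _≤_)
open import Data.Product using (_×_)

import Data.Nat as ℕ
open import Level using (_⊔_)
open import Data.Nat using (zero; suc; z≤n; s≤s)
open import Data.Nat.Properties using (+-suc; <⇒≤; ≤-reflexive)
open import Data.Product using (_,_; proj₁; proj₂)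
open import Data.Fin using (Fin; zero; suc; punchIn) renaming (_≟_ to _≟ᶠ_)
open import Data.Fin.Properties using (punchInᵢ≢i)
open import Data.List using (List; []; _∷_; length)
open import Data.Vec using (Vec; []; _∷_; toList; replicate)
open import Data.Vec.Properties using (length-toList)
open import Relation.Binary.Bundles using (Setoid)
open import Data.Vec.Relation.Binary.Pointwise.Inductive as Pointwise using (Pointwise; []; _∷_)
open import Function using (_∘_)
open import Data.Empty using (⊥-elim)
open import Relation.Nullary using (Dec; yes; no; ¬_)
import Relation.Binary.PropositionalEquality as ≡
import Relation.Binary.Reasoning.Setoid

-- We work with jets: the jet of a polynomial at x is the family of all its
-- iterated partial derivatives there.  Jets form an algebra under the Leibniz
-- product, and the chain rule for the linear substitution in g ⋆ Ω says that
-- the jet of p(gᵀx) at x is the jet of p at y = gᵀx with every direction of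
-- differentiation transformed by g ("pull").  So in g ⋆ Ω the matrix indices
-- transform by h = g⁻¹ and the directions by g; as these are dual
-- (Σ_r h_br g_rv = δ_bv) the covariance survives the contractions defining M
-- and N.  Hence ∂²M and ∂³N are mixed tensors transforming by h on matrix
-- indices and by gᵀ on directions, and c₄, c₆ are (up to a constant factor)
-- full contractions of these tensors with their transposes, which are
-- invariant.  Finally, for quadratic Ω these tensors are constant, so
-- evaluating at y instead of x changes nothing.

module Invariance {c ℓ : Level} (K : Field c ℓ) where
  open Field K hiding (zero)
  open import Algebra.Properties.Semiring.Sum semiring
    using (sum; sum-cong-≋; sum-replicate-zero; sum-remove; ∑-comm; ∑-distrib-+;
           *-distribˡ-sum; *-distribʳ-sum)
  open import Algebra.Properties.Ring ring using (-‿distribʳ-*)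
  open import Algebra.Properties.CommutativeSemigroup *-commutativeSemigroup
    using () renaming (x∙yz≈y∙xz to *-lcomm)
  open import Algebra.Properties.AbelianGroup +-abelianGroup using (⁻¹-∙-comm; ε⁻¹≈ε)
  module ≈-Reasoning = Relation.Binary.Reasoning.Setoid setoid

  module FiniteSums where
    open ≈-Reasoning

    ΣK≡sum : ∀ {m} (f : Fin m → Carrier) → ΣK K f ≡.≡ sum f
    ΣK≡sum {zero}  f = ≡.refl
    ΣK≡sum {suc m} f = ≡.cong (f zero +_) (ΣK≡sum (f ∘ suc))

    sum-cong : ∀ {m} {f f' : Fin m → Carrier} → (∀ i → f i ≈ f' i) → sum f ≈ sum f'
    sum-cong = sum-cong-≋

    sum-zero : ∀ {m} → sum {m} (λ _ → 0#) ≈ 0#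
    sum-zero {m} = sum-replicate-zero m

    -‿sum : ∀ {m} (f : Fin m → Carrier) → - sum f ≈ sum (λ i → - f i)
    -‿sum {zero}  f = ε⁻¹≈ε
    -‿sum {suc m} f = trans (sym (⁻¹-∙-comm _ _)) (+-congˡ (-‿sum (f ∘ suc)))

    sum-comm-weighted : ∀ {m k} (α : Fin m → Carrier) (β : Fin k → Carrier) (F : Fin m → Fin k → Carrier) →
      sum (λ a → α a * sum (λ b → β b * F a b)) ≈ sum (λ b → β b * sum (λ a → α a * F a b))
    sum-comm-weighted α β F = begin
      sum (λ a → α a * sum (λ b → β b * F a b))    ≈⟨ sum-cong (λ a → *-distribˡ-sum (α a) (λ b → β b * F a b)) ⟩
      sum (λ a → sum (λ b → α a * (β b * F a b)))  ≈⟨ sum-cong (λ a → sum-cong (λ b → *-lcomm (α a) (β b) _)) ⟩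
      sum (λ a → sum (λ b → β b * (α a * F a b)))  ≈⟨ ∑-comm (λ a b → β b * (α a * F a b)) ⟩
      sum (λ b → sum (λ a → β b * (α a * F a b)))  ≈⟨ sum-cong (λ b → *-distribˡ-sum (β b) (λ a → α a * F a b)) ⟨
      sum (λ b → β b * sum (λ a → α a * F a b))    ∎

    sum-into-weighted : ∀ {m k} (α : Fin k → Carrier) (F : Fin m → Fin k → Carrier) →
      sum (λ u → sum (λ a → α a * F u a)) ≈ sum (λ a → α a * sum (λ u → F u a))
    sum-into-weighted α F =
      trans (∑-comm (λ u a → α a * F u a)) (sum-cong (λ a → sym (*-distribˡ-sum (α a) (λ u → F u a))))

    δ-diag : ∀ {m} (i : Fin m) → δ K i i ≡.≡ 1#
    δ-diag i with i ≟ᶠ i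
    ... | yes _  = ≡.refl
    ... | no i≢i = ⊥-elim (i≢i ≡.refl)

    δ-off : ∀ {m} {i j : Fin m} → ¬ i ≡.≡ j → δ K i j ≡.≡ 0#
    δ-off {i = i} {j} i≢j with i ≟ᶠ j
    ... | yes i≡j = ⊥-elim (i≢j i≡j)
    ... | no _    = ≡.refl

    δ-sym : ∀ {m} (i j : Fin m) → δ K i j ≡.≡ δ K j i
    δ-sym i j = by-cases (i ≟ᶠ j)
      where
      by-cases : Dec (i ≡.≡ j) → δ K i j ≡.≡ δ K j i
      by-cases (yes i≡j) = ≡.cong₂ (δ K) i≡j (≡.sym i≡j)
      by-cases (no i≢j)  = ≡.trans (δ-off i≢j) (≡.sym (δ-off (i≢j ∘ ≡.sym)))

    sum-δ : ∀ {m} (a : Fin m) (f : Fin m → Carrier) → sum (λ b → δ K a b * f b) ≈ f a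
    sum-δ {suc m} a f = begin
      sum (λ b → δ K a b * f b)                          ≈⟨ sum-remove {i = a} (λ b → δ K a b * f b) ⟩
      δ K a a * f a + sum (λ b → δ K a (punchIn a b) * f (punchIn a b))
        ≈⟨ +-cong (*-congʳ (reflexive (δ-diag a)))
                  (sum-cong (λ b → *-congʳ (reflexive (δ-off (punchInᵢ≢i a b ∘ ≡.sym))))) ⟩
      1# * f a + sum (λ b → 0# * f (punchIn a b))
        ≈⟨ +-cong (*-identityˡ _) (sum-cong (λ b → zeroˡ (f (punchIn a b)))) ⟩
      f a + sum {m} (λ _ → 0#)                           ≈⟨ +-congˡ (sum-zero {m}) ⟩
      f a + 0#                                           ≈⟨ +-identityʳ _ ⟩
      f a                                                ∎

    -- Dual matrices.  Dual P Q says P Qᵀ = 1, i.e. an index transformed by P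
    -- may be contracted against an index transformed by Q.

    Dual : ∀ {n} → Mat K n → Mat K n → Set ℓ
    Dual P Q = ∀ a b → sum (λ i → P a i * Q b i) ≈ δ K a b

    Dual-sym : ∀ {n} {P Q : Mat K n} → Dual P Q → Dual Q P
    Dual-sym {P = P} {Q} dual a b = begin
      sum (λ i → Q a i * P b i) ≈⟨ sum-cong (λ i → *-comm (Q a i) (P b i)) ⟩
      sum (λ i → P b i * Q a i) ≈⟨ dual b a ⟩
      δ K b a                   ≡⟨ δ-sym b a ⟩
      δ K a b                   ∎

    contract : ∀ {n} {P Q : Mat K n} → Dual P Q → (Z : Fin n → Fin n → Carrier) →
      sum (λ i → sum (λ a → P a i * sum (λ b → Q b i * Z a b))) ≈ sum (λ a → Z a a)
    contract {P = P} {Q} dual Z = begin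
      sum (λ i → sum (λ a → P a i * sum (λ b → Q b i * Z a b)))
        ≈⟨ sum-cong (λ i → sum-cong (λ a → *-distribˡ-sum (P a i) (λ b → Q b i * Z a b))) ⟩
      sum (λ i → sum (λ a → sum (λ b → P a i * (Q b i * Z a b))))
        ≈⟨ ∑-comm (λ i a → sum (λ b → P a i * (Q b i * Z a b))) ⟩
      sum (λ a → sum (λ i → sum (λ b → P a i * (Q b i * Z a b))))
        ≈⟨ sum-cong (λ a → ∑-comm (λ i b → P a i * (Q b i * Z a b))) ⟩
      sum (λ a → sum (λ b → sum (λ i → P a i * (Q b i * Z a b))))
        ≈⟨ sum-cong (λ a → sum-cong (λ b → sum-cong (λ i → *-assoc (P a i) (Q b i) (Z a b)))) ⟨
      sum (λ a → sum (λ b → sum (λ i → (P a i * Q b i) * Z a b)))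
        ≈⟨ sum-cong (λ a → sum-cong (λ b → *-distribʳ-sum (Z a b) (λ i → P a i * Q b i))) ⟨
      sum (λ a → sum (λ b → sum (λ i → P a i * Q b i) * Z a b))
        ≈⟨ sum-cong (λ a → sum-cong (λ b → *-congʳ (dual a b))) ⟩
      sum (λ a → sum (λ b → δ K a b * Z a b))
        ≈⟨ sum-cong (λ a → sum-δ a (Z a)) ⟩
      sum (λ a → Z a a) ∎

    *-expand : ∀ {n} (α β X Y : Fin n → Carrier) →
      sum (λ a → α a * X a) * sum (λ b → β b * Y b) ≈ sum (λ a → α a * sum (λ b → β b * (X a * Y b)))
    *-expand α β X Y = begin
      sum (λ a → α a * X a) * sum (λ b → β b * Y b)
        ≈⟨ *-distribʳ-sum _ (λ a → α a * X a) ⟩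
      sum (λ a → (α a * X a) * sum (λ b → β b * Y b))
        ≈⟨ sum-cong (λ a → trans (*-assoc (α a) (X a) _) (*-congˡ (*-distribˡ-sum (X a) (λ b → β b * Y b)))) ⟩
      sum (λ a → α a * sum (λ b → X a * (β b * Y b)))
        ≈⟨ sum-cong (λ a → *-congˡ (sum-cong (λ b → *-lcomm (X a) (β b) (Y b)))) ⟩
      sum (λ a → α a * sum (λ b → β b * (X a * Y b))) ∎

  open FiniteSums

  module Tensors where
    open ≈-Reasoning

    Tensor : ℕ → ℕ → Set c
    Tensor n k = Vec (Fin n) k → Carrier

    Σⱽ : ∀ {n k} → Tensor n k → Carrier
    Σⱽ {k = zero}  A = A []
    Σⱽ {k = suc k} A = sum (λ i → Σⱽ (λ I → A (i ∷ I)))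

    Σⱽ-cong : ∀ {n k} {A B : Tensor n k} → (∀ I → A I ≈ B I) → Σⱽ A ≈ Σⱽ B
    Σⱽ-cong {k = zero}  e = e []
    Σⱽ-cong {k = suc k} e = sum-cong (λ i → Σⱽ-cong (λ I → e (i ∷ I)))

    Σⱽ-*ˡ : ∀ {n k} (a : Carrier) (A : Tensor n k) → Σⱽ (λ I → a * A I) ≈ a * Σⱽ A
    Σⱽ-*ˡ {k = zero}  a A = refl
    Σⱽ-*ˡ {k = suc k} a A =
      trans (sum-cong (λ i → Σⱽ-*ˡ a (λ I → A (i ∷ I)))) (sym (*-distribˡ-sum a (λ i → Σⱽ (λ I → A (i ∷ I)))))

    Σⱽ-sum : ∀ {n k m} (F : Fin m → Tensor n k) → Σⱽ (λ I → sum (λ a → F a I)) ≈ sum (λ a → Σⱽ (F a))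
    Σⱽ-sum {k = zero}  F = refl
    Σⱽ-sum {k = suc k} F =
      trans (sum-cong (λ i → Σⱽ-sum (λ a I → F a (i ∷ I)))) (∑-comm (λ i a → Σⱽ (λ I → F a (i ∷ I))))

    Σⱽ-comm : ∀ {n k m} (A : Vec (Fin n) k → Vec (Fin n) m → Carrier) →
      Σⱽ (λ I → Σⱽ (λ R → A I R)) ≈ Σⱽ (λ R → Σⱽ (λ I → A I R))
    Σⱽ-comm {k = zero}  A = refl
    Σⱽ-comm {k = suc k} A =
      trans (sum-cong (λ i → Σⱽ-comm (λ I R → A (i ∷ I) R))) (sym (Σⱽ-sum (λ i R → Σⱽ (λ I → A (i ∷ I) R))))

    transform : ∀ {n k} → Vec (Mat K n) k → Tensor n k → Tensor n k
    transform []       A []      = A []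
    transform (P ∷ Ps) A (i ∷ I) = sum (λ a → P a i * transform Ps (λ J → A (a ∷ J)) I)

    transform-linear : ∀ {n k m} (Ps : Vec (Mat K n) k) (α : Fin m → Carrier) (F : Fin m → Tensor n k) I →
      transform Ps (λ J → sum (λ a → α a * F a J)) I ≈ sum (λ a → α a * transform Ps (F a) I)
    transform-linear []       α F []      = refl
    transform-linear (P ∷ Ps) α F (i ∷ I) = begin
      sum (λ b → P b i * transform Ps (λ J → sum (λ a → α a * F a (b ∷ J))) I)
        ≈⟨ sum-cong (λ b → *-congˡ (transform-linear Ps α (λ a J → F a (b ∷ J)) I)) ⟩
      sum (λ b → P b i * sum (λ a → α a * transform Ps (λ J → F a (b ∷ J)) I))
        ≈⟨ sum-comm-weighted (λ b → P b i) α (λ b a → transform Ps (λ J → F a (b ∷ J)) I) ⟩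
      sum (λ a → α a * sum (λ b → P b i * transform Ps (λ J → F a (b ∷ J)) I)) ∎

    transform-comm : ∀ {n k m} (Ps : Vec (Mat K n) k) (Qs : Vec (Mat K n) m)
      (A : Vec (Fin n) k → Tensor n m) I R →
      transform Ps (λ I' → transform Qs (A I') R) I ≈ transform Qs (λ R' → transform Ps (λ I' → A I' R') I) R
    transform-comm []       Qs A []      R = refl
    transform-comm (P ∷ Ps) Qs A (i ∷ I) R = begin
      sum (λ a → P a i * transform Ps (λ J → transform Qs (A (a ∷ J)) R) I)
        ≈⟨ sum-cong (λ a → *-congˡ (transform-comm Ps Qs (λ J → A (a ∷ J)) I R)) ⟩
      sum (λ a → P a i * transform Qs (λ R' → transform Ps (λ J → A (a ∷ J) R') I) R)
        ≈⟨ transform-linear Qs (λ a → P a i) (λ a R' → transform Ps (λ J → A (a ∷ J) R') I) R ⟨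
      transform Qs (λ R' → sum (λ a → P a i * transform Ps (λ J → A (a ∷ J) R') I)) R ∎

    contraction-invariant : ∀ {n k} {Ps Qs : Vec (Mat K n) k} → Pointwise Dual Ps Qs →
      (A B : Tensor n k) → Σⱽ (λ I → transform Ps A I * transform Qs B I) ≈ Σⱽ (λ I → A I * B I)
    contraction-invariant [] A B = refl
    contraction-invariant {n} {suc k} {P ∷ Ps} {Q ∷ Qs} (dual ∷ duals) A B = begin
      sum (λ i → Σⱽ (λ I → sum (λ a → P a i * X a I) * sum (λ b → Q b i * Y b I)))
        ≈⟨ sum-cong (λ i → Σⱽ-cong (λ I →
             *-expand (λ a → P a i) (λ b → Q b i) (λ a → X a I) (λ b → Y b I))) ⟩
      sum (λ i → Σⱽ (λ I → sum (λ a → P a i * sum (λ b → Q b i * (X a I * Y b I)))))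
        ≈⟨ sum-cong (λ i → Σⱽ-linear₂ (λ a → P a i) (λ b → Q b i) (λ a b I → X a I * Y b I)) ⟩
      sum (λ i → sum (λ a → P a i * sum (λ b → Q b i * Σⱽ (λ I → X a I * Y b I))))
        ≈⟨ contract dual (λ a b → Σⱽ (λ I → X a I * Y b I)) ⟩
      sum (λ a → Σⱽ (λ I → X a I * Y a I))
        ≈⟨ sum-cong (λ a → contraction-invariant duals (λ J → A (a ∷ J)) (λ J → B (a ∷ J))) ⟩
      sum (λ a → Σⱽ (λ I → A (a ∷ I) * B (a ∷ I))) ∎
      where
      X Y : Fin n → Tensor n k
      X a = transform Ps (λ J → A (a ∷ J))
      Y b = transform Qs (λ J → B (b ∷ J))
      Σⱽ-linear : (α : Fin n → Carrier) (F : Fin n → Tensor n k) →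
        Σⱽ (λ I → sum (λ a → α a * F a I)) ≈ sum (λ a → α a * Σⱽ (F a))
      Σⱽ-linear α F = trans (Σⱽ-sum (λ a I → α a * F a I)) (sum-cong (λ a → Σⱽ-*ˡ (α a) (F a)))
      Σⱽ-linear₂ : (α β : Fin n → Carrier) (F : Fin n → Fin n → Tensor n k) →
        Σⱽ (λ I → sum (λ a → α a * sum (λ b → β b * F a b I))) ≈
        sum (λ a → α a * sum (λ b → β b * Σⱽ (F a b)))
      Σⱽ-linear₂ α β F = trans (Σⱽ-linear α (λ a I → sum (λ b → β b * F a b I)))
                               (sum-cong (λ a → *-congˡ (Σⱽ-linear β (F a))))

    replicate-dual : ∀ {n} k {P Q : Mat K n} → Dual P Q → Pointwise Dual (replicate k P) (replicate k Q)
    replicate-dual zero    dual = []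
    replicate-dual (suc k) dual = dual ∷ replicate-dual k dual

    -- Mixed tensors X I R carry k matrix indices I and k direction indices R;
    -- ⟪ X ⟫ contracts X with its transpose.
    ⟪_⟫ : ∀ {n k} → (Vec (Fin n) k → Tensor n k) → Carrier
    ⟪ X ⟫ = Σⱽ (λ I → Σⱽ (λ R → X I R * X R I))

    ⟪⟫-cong : ∀ {n k} {X Y : Vec (Fin n) k → Tensor n k} → (∀ I R → X I R ≈ Y I R) → ⟪ X ⟫ ≈ ⟪ Y ⟫
    ⟪⟫-cong e = Σⱽ-cong (λ I → Σⱽ-cong (λ R → *-cong (e I R) (e R I)))

    mixed-transform : ∀ {n k} → Vec (Mat K n) k → Vec (Mat K n) k →
      (Vec (Fin n) k → Tensor n k) → Vec (Fin n) k → Tensor n k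
    mixed-transform Hs Gs X I R = transform Gs (λ R' → transform Hs (λ I' → X I' R') I) R

    ⟪⟫-invariant : ∀ {n k} {Hs Gs : Vec (Mat K n) k} → Pointwise Dual Hs Gs →
      (X : Vec (Fin n) k → Tensor n k) → ⟪ mixed-transform Hs Gs X ⟫ ≈ ⟪ X ⟫
    ⟪⟫-invariant {n} {k} {Hs} {Gs} duals X = begin
      Σⱽ (λ I → Σⱽ (λ R → transform Gs (λ R' → transform Hs (λ I' → X I' R') I) R * Xᵀ' R I))
        ≈⟨ Σⱽ-cong (λ I → Σⱽ-cong (λ R → *-congʳ (sym (transform-comm Hs Gs X I R)))) ⟩
      Σⱽ (λ I → Σⱽ (λ R → transform Hs (λ I' → transform Gs (X I') R) I * Xᵀ' R I))
        ≈⟨ Σⱽ-comm (λ I R → transform Hs (λ I' → transform Gs (X I') R) I * Xᵀ' R I) ⟩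
      Σⱽ (λ R → Σⱽ (λ I → transform Hs (λ I' → transform Gs (X I') R) I * Xᵀ' R I))
        ≈⟨ Σⱽ-cong (λ R → contraction-invariant duals (λ I' → transform Gs (X I') R)
                                                     (λ I' → transform Hs (λ R' → X R' I') R)) ⟩
      Σⱽ (λ R → Σⱽ (λ I → transform Gs (X I) R * transform Hs (λ R' → X R' I) R))
        ≈⟨ Σⱽ-comm (λ I R → transform Gs (X I) R * transform Hs (λ R' → X R' I) R) ⟨
      Σⱽ (λ I → Σⱽ (λ R → transform Gs (X I) R * transform Hs (λ R' → X R' I) R))
        ≈⟨ Σⱽ-cong (λ I → contraction-invariant (Pointwise.sym Dual-sym duals) (X I) (λ R' → X R' I)) ⟩
      Σⱽ (λ I → Σⱽ (λ R → X I R * X R I)) ∎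
      where
      Xᵀ' : Vec (Fin n) k → Tensor n k
      Xᵀ' R I = mixed-transform Hs Gs X R I

  open Tensors

  -- Jets.  The jet of a polynomial at a point is the family of all its
  -- iterated partial derivatives there, indexed by the list of directions.

  module Jets (n : ℕ) where

    Jet : Set c
    Jet = List (Fin n) → Carrier

    infix 4 _≈ᴶ_
    _≈ᴶ_ : Jet → Jet → Set ℓ
    P ≈ᴶ Q = ∀ ds → P ds ≈ Q ds

    jet-setoid : Setoid c ℓ
    jet-setoid = record
      { Carrier       = Jet
      ; _≈_           = _≈ᴶ_
      ; isEquivalence = record
        { refl  = λ _ → refl
        ; sym   = λ e ds → sym (e ds)
        ; trans = λ e f ds → trans (e ds) (f ds)
        }
      }

    module ≈ᴶ-Reasoning = Relation.Binary.Reasoning.Setoid jet-setoid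

    ∂ᴶ : Fin n → Jet → Jet
    ∂ᴶ d P ds = P (d ∷ ds)

    const : Carrier → Jet
    const a []      = a
    const a (_ ∷ _) = 0#

    infixl 6 _+ᴶ_
    infixr 7 _·ᴶ_ _▷_
    infixl 7 _⊛_

    _+ᴶ_ : Jet → Jet → Jet
    (P +ᴶ Q) ds = P ds + Q ds

    -ᴶ_ : Jet → Jet
    (-ᴶ P) ds = - P ds

    _·ᴶ_ : Carrier → Jet → Jet
    (a ·ᴶ P) ds = a * P ds

    ΣJ : ∀ {m} → (Fin m → Jet) → Jet
    ΣJ F ds = sum (λ a → F a ds)

    _▷_ : ∀ {m} → (Fin m → Carrier) → (Fin m → Jet) → Jet
    (α ▷ F) ds = sum (λ a → α a * F a ds)

    -- the Leibniz rule, ∂(PQ) = (∂P)Q + P(∂Q), defines the product of jets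
    _⊛_ : Jet → Jet → Jet
    (P ⊛ Q) []       = P [] * Q []
    (P ⊛ Q) (d ∷ ds) = (∂ᴶ d P ⊛ Q) ds + (P ⊛ ∂ᴶ d Q) ds

    ▷-cong : ∀ {m} (α : Fin m → Carrier) {F G : Fin m → Jet} → (∀ a → F a ≈ᴶ G a) → α ▷ F ≈ᴶ α ▷ G
    ▷-cong α e ds = sum-cong (λ a → *-congˡ (e a ds))

    ΣJ-cong : ∀ {m} {F G : Fin m → Jet} → (∀ a → F a ≈ᴶ G a) → ΣJ F ≈ᴶ ΣJ G
    ΣJ-cong e ds = sum-cong (λ a → e a ds)

    ΣJ-comm : ∀ {m k} (F : Fin m → Fin k → Jet) → ΣJ (λ a → ΣJ (F a)) ≈ᴶ ΣJ (λ b → ΣJ (λ a → F a b))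
    ΣJ-comm F ds = ∑-comm (λ a b → F a b ds)

    ▷-comm : ∀ {m k} (α : Fin m → Carrier) (β : Fin k → Carrier) (F : Fin m → Fin k → Jet) →
      α ▷ (λ a → β ▷ F a) ≈ᴶ β ▷ (λ b → α ▷ (λ a → F a b))
    ▷-comm α β F ds = sum-comm-weighted α β (λ a b → F a b ds)

    ΣJ-▷ : ∀ {m k} (α : Fin k → Carrier) (F : Fin m → Fin k → Jet) →
      ΣJ (λ u → α ▷ F u) ≈ᴶ α ▷ (λ a → ΣJ (λ u → F u a))
    ΣJ-▷ α F ds = sum-into-weighted α (λ u a → F u a ds)

    ▷-cong² : ∀ {k l} (α : Fin k → Carrier) (β : Fin l → Carrier) {F G : Fin k → Fin l → Jet} →
      (∀ a b → F a b ≈ᴶ G a b) →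
      α ▷ (λ a → β ▷ F a) ≈ᴶ α ▷ (λ a → β ▷ G a)
    ▷-cong² α β e = ▷-cong α (λ a → ▷-cong β (e a))

    ΣJ-▷² : ∀ {m} (α β : Fin n → Carrier) (F : Fin m → Fin n → Fin n → Jet) →
      ΣJ (λ u → α ▷ λ a → β ▷ F u a) ≈ᴶ α ▷ (λ a → β ▷ λ b → ΣJ (λ u → F u a b))
    ΣJ-▷² α β F = begin
      ΣJ (λ u → α ▷ λ a → β ▷ F u a)           ≈⟨ ΣJ-▷ α (λ u a → β ▷ F u a) ⟩
      α ▷ (λ a → ΣJ (λ u → β ▷ F u a))         ≈⟨ ▷-cong α (λ a → ΣJ-▷ β (λ u → F u a)) ⟩
      α ▷ (λ a → β ▷ λ b → ΣJ (λ u → F u a b)) ∎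
      where open ≈ᴶ-Reasoning

    ΣJ-▷³ : ∀ {m} (α β γ : Fin n → Carrier) (F : Fin m → Fin n → Fin n → Fin n → Jet) →
      ΣJ (λ u → α ▷ λ a → β ▷ λ b → γ ▷ F u a b) ≈ᴶ
      α ▷ (λ a → β ▷ λ b → γ ▷ λ c → ΣJ (λ u → F u a b c))
    ΣJ-▷³ α β γ F ds =
      trans (ΣJ-▷² α β (λ u a b → γ ▷ F u a b) ds) (▷-cong² α β (λ a b → ΣJ-▷ γ (λ u → F u a b)) ds)

    ⊛-cong : ∀ {P P' Q Q'} → P ≈ᴶ P' → Q ≈ᴶ Q' → P ⊛ Q ≈ᴶ P' ⊛ Q'
    ⊛-cong eP eQ []       = *-cong (eP []) (eQ [])
    ⊛-cong eP eQ (d ∷ ds) = +-cong (⊛-cong (λ ds → eP (d ∷ ds)) eQ ds) (⊛-cong eP (λ ds → eQ (d ∷ ds)) ds)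

    ⊛-zeroˡ : ∀ {P} Q → (∀ ds → P ds ≈ 0#) → ∀ ds → (P ⊛ Q) ds ≈ 0#
    ⊛-zeroˡ Q z []       = trans (*-congʳ (z [])) (zeroˡ (Q []))
    ⊛-zeroˡ Q z (d ∷ ds) =
      trans (+-cong (⊛-zeroˡ Q (λ ds → z (d ∷ ds)) ds) (⊛-zeroˡ (∂ᴶ d Q) z ds)) (+-identityˡ 0#)

    ⊛-zeroʳ : ∀ P {Q} → (∀ ds → Q ds ≈ 0#) → ∀ ds → (P ⊛ Q) ds ≈ 0#
    ⊛-zeroʳ P z []       = trans (*-congˡ (z [])) (zeroʳ (P []))
    ⊛-zeroʳ P z (d ∷ ds) =
      trans (+-cong (⊛-zeroʳ (∂ᴶ d P) z ds) (⊛-zeroʳ P (λ ds → z (d ∷ ds)) ds)) (+-identityˡ 0#)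

    ⊛-constˡ : ∀ a Q → const a ⊛ Q ≈ᴶ a ·ᴶ Q
    ⊛-constˡ a Q []       = refl
    ⊛-constˡ a Q (d ∷ ds) =
      trans (+-cong (⊛-zeroˡ Q (λ _ → refl) ds) (⊛-constˡ a (∂ᴶ d Q) ds)) (+-identityˡ _)

    ⊛-constʳ : ∀ a P → P ⊛ const a ≈ᴶ a ·ᴶ P
    ⊛-constʳ a P []       = *-comm (P []) a
    ⊛-constʳ a P (d ∷ ds) =
      trans (+-cong (⊛-constʳ a (∂ᴶ d P) ds) (⊛-zeroʳ P (λ _ → refl) ds)) (+-identityʳ _)

    ⊛-▷ˡ : ∀ {m} (α : Fin m → Carrier) (F : Fin m → Jet) Q → (α ▷ F) ⊛ Q ≈ᴶ α ▷ (λ a → F a ⊛ Q)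
    ⊛-▷ˡ α F Q [] = trans (*-distribʳ-sum (Q []) (λ a → α a * F a []))
                         (sum-cong (λ a → *-assoc (α a) (F a []) (Q [])))
    ⊛-▷ˡ α F Q (d ∷ ds) = begin
      ((α ▷ λ a → ∂ᴶ d (F a)) ⊛ Q) ds + ((α ▷ F) ⊛ ∂ᴶ d Q) ds
        ≈⟨ +-cong (⊛-▷ˡ α (λ a → ∂ᴶ d (F a)) Q ds) (⊛-▷ˡ α F (∂ᴶ d Q) ds) ⟩
      sum (λ a → α a * (∂ᴶ d (F a) ⊛ Q) ds) + sum (λ a → α a * (F a ⊛ ∂ᴶ d Q) ds)
        ≈⟨ ∑-distrib-+ (λ a → α a * (∂ᴶ d (F a) ⊛ Q) ds) (λ a → α a * (F a ⊛ ∂ᴶ d Q) ds) ⟨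
      sum (λ a → α a * (∂ᴶ d (F a) ⊛ Q) ds + α a * (F a ⊛ ∂ᴶ d Q) ds)
        ≈⟨ sum-cong (λ a → distribˡ (α a) _ _) ⟨
      sum (λ a → α a * (F a ⊛ Q) (d ∷ ds)) ∎
      where open ≈-Reasoning

    ⊛-▷ʳ : ∀ {m} P (α : Fin m → Carrier) (F : Fin m → Jet) → P ⊛ (α ▷ F) ≈ᴶ α ▷ (λ a → P ⊛ F a)
    ⊛-▷ʳ P α F [] = trans (*-distribˡ-sum (P []) (λ a → α a * F a []))
                         (sum-cong (λ a → *-lcomm (P []) (α a) (F a [])))
    ⊛-▷ʳ P α F (d ∷ ds) = begin
      (∂ᴶ d P ⊛ (α ▷ F)) ds + (P ⊛ (α ▷ λ a → ∂ᴶ d (F a))) ds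
        ≈⟨ +-cong (⊛-▷ʳ (∂ᴶ d P) α F ds) (⊛-▷ʳ P α (λ a → ∂ᴶ d (F a)) ds) ⟩
      sum (λ a → α a * (∂ᴶ d P ⊛ F a) ds) + sum (λ a → α a * (P ⊛ ∂ᴶ d (F a)) ds)
        ≈⟨ ∑-distrib-+ (λ a → α a * (∂ᴶ d P ⊛ F a) ds) (λ a → α a * (P ⊛ ∂ᴶ d (F a)) ds) ⟨
      sum (λ a → α a * (∂ᴶ d P ⊛ F a) ds + α a * (P ⊛ ∂ᴶ d (F a)) ds)
        ≈⟨ sum-cong (λ a → distribˡ (α a) _ _) ⟨
      sum (λ a → α a * (P ⊛ F a) (d ∷ ds)) ∎
      where open ≈-Reasoning

    ⊛-expand : ∀ {m k} (α : Fin m → Carrier) (X : Fin m → Jet) (β : Fin k → Carrier) (Y : Fin k → Jet) →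
      (α ▷ X) ⊛ (β ▷ Y) ≈ᴶ α ▷ (λ a → β ▷ (λ b → X a ⊛ Y b))
    ⊛-expand α X β Y = begin
      (α ▷ X) ⊛ (β ▷ Y)                     ≈⟨ ⊛-▷ˡ α X (β ▷ Y) ⟩
      α ▷ (λ a → X a ⊛ (β ▷ Y))             ≈⟨ ▷-cong α (λ a → ⊛-▷ʳ (X a) β Y) ⟩
      α ▷ (λ a → β ▷ (λ b → X a ⊛ Y b))     ∎
      where open ≈ᴶ-Reasoning

    contractᴶ : ∀ {P Q : Mat K n} → Dual P Q → (X Y : Fin n → Jet) →
      ΣJ (λ r → ((λ a → P a r) ▷ X) ⊛ ((λ b → Q b r) ▷ Y)) ≈ᴶ ΣJ (λ a → X a ⊛ Y a)
    contractᴶ {P} {Q} dual X Y ds =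
      trans (sum-cong (λ r → ⊛-expand (λ a → P a r) X (λ b → Q b r) Y ds))
            (contract dual (λ a b → (X a ⊛ Y b) ds))

    ∂* : List (Fin n) → Poly K n → Poly K n
    ∂* []       p = p
    ∂* (d ∷ ds) p = ∂* ds (∂ K d p)

    jet : Poly K n → (Fin n → Carrier) → Jet
    jet p x ds = eval K (∂* ds p) x

    jet-⊕ : ∀ p q x → jet (p ⊕ q) x ≈ᴶ jet p x +ᴶ jet q x
    jet-⊕ p q x []       = refl
    jet-⊕ p q x (d ∷ ds) = jet-⊕ (∂ K d p) (∂ K d q) x ds

    jet-⊝ : ∀ p x → jet (⊝ p) x ≈ᴶ -ᴶ jet p x
    jet-⊝ p x []       = refl
    jet-⊝ p x (d ∷ ds) = jet-⊝ (∂ K d p) x ds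

    jet-⊗ : ∀ p q x → jet (p ⊗ q) x ≈ᴶ jet p x ⊛ jet q x
    jet-⊗ p q x []       = refl
    jet-⊗ p q x (d ∷ ds) =
      trans (jet-⊕ (∂ K d p ⊗ q) (p ⊗ ∂ K d q) x ds)
            (+-cong (jet-⊗ (∂ K d p) q x ds) (jet-⊗ p (∂ K d q) x ds))

    jet-con : ∀ a x → jet (con a) x ≈ᴶ const a
    jet-con a x []           = refl
    jet-con a x (_ ∷ [])     = refl
    jet-con a x (_ ∷ e ∷ ds) = jet-con 0# x (e ∷ ds)

    jet-ΣP : ∀ {m} (f : Fin m → Poly K n) x → jet (ΣP K f) x ≈ᴶ ΣJ (λ i → jet (f i) x)
    jet-ΣP {zero}  f x ds = trans (jet-con 0# x ds) (const-0 ds)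
      where
      const-0 : ∀ ds → const 0# ds ≈ 0#
      const-0 []      = refl
      const-0 (_ ∷ _) = refl
    jet-ΣP {suc m} f x ds =
      trans (jet-⊕ (f zero) (ΣP K (f ∘ suc)) x ds) (+-congˡ (jet-ΣP (f ∘ suc) x ds))

    eval-ΣP² : ∀ (f : Fin n → Fin n → Poly K n) x →
      eval K (ΣP K λ i → ΣP K λ j → f i j) x ≈ sum (λ i → sum (λ j → eval K (f i j) x))
    eval-ΣP² f x = trans (jet-ΣP (λ i → ΣP K (f i)) x []) (sum-cong (λ i → jet-ΣP (f i) x []))

    -- A polynomial of degree ≤ k has vanishing derivatives of order
    -- > k and constant derivatives of order k.  Constancy is what the theorem
    -- needs; vanishing is what makes constancy stable under products.

    _≈[≥_]_ : Jet → ℕ → Jet → Set ℓ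
    P ≈[≥ k ] P' = ∀ ds → k ≤ length ds → P ds ≈ P' ds

    Vanishes : ℕ → Jet → Set ℓ
    Vanishes k P = ∀ ds → k ℕ.< length ds → P ds ≈ 0#

    Vanishes-∂ : ∀ {k P} d → Vanishes (suc k) P → Vanishes k (∂ᴶ d P)
    Vanishes-∂ d v ds lt = v (d ∷ ds) (s≤s lt)

    agree-∂ : ∀ {k P P'} d → P ≈[≥ suc k ] P' → ∂ᴶ d P ≈[≥ k ] ∂ᴶ d P'
    agree-∂ d e ds le = e (d ∷ ds) (s≤s le)

    ⊛-agree : ∀ a b {P P' Q Q'} → Vanishes a P → Vanishes a P' → Vanishes b Q → Vanishes b Q' →
      P ≈[≥ a ] P' → Q ≈[≥ b ] Q' → (P ⊛ Q) ≈[≥ a ℕ.+ b ] (P' ⊛ Q')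
    ⊛-agree zero    zero    _  _   _  _   eP eQ [] z≤n = *-cong (eP [] z≤n) (eQ [] z≤n)
    ⊛-agree (suc a) b       _  _   _  _   _  _  [] ()
    ⊛-agree zero    (suc b) _  _   _  _   _  _  [] ()
    ⊛-agree a b {P} {P'} {Q} {Q'} vP vP' vQ vQ' eP eQ (d ∷ ds) le =
      +-cong (left a vP vP' eP le) (right b vQ vQ' eQ le)
      where
      left : ∀ a {P P'} → Vanishes a P → Vanishes a P' → P ≈[≥ a ] P' → a ℕ.+ b ≤ suc (length ds) →
             (∂ᴶ d P ⊛ Q) ds ≈ (∂ᴶ d P' ⊛ Q') ds
      left zero vP vP' _ _ =
        trans (⊛-zeroˡ Q (λ ds → vP (d ∷ ds) (s≤s z≤n)) ds)
              (sym (⊛-zeroˡ Q' (λ ds → vP' (d ∷ ds) (s≤s z≤n)) ds))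
      left (suc a) vP vP' eP (s≤s le) =
        ⊛-agree a b (Vanishes-∂ d vP) (Vanishes-∂ d vP') vQ vQ' (agree-∂ d eP) eQ ds le
      right : ∀ b {Q Q'} → Vanishes b Q → Vanishes b Q' → Q ≈[≥ b ] Q' → a ℕ.+ b ≤ suc (length ds) →
              (P ⊛ ∂ᴶ d Q) ds ≈ (P' ⊛ ∂ᴶ d Q') ds
      right zero vQ vQ' _ _ =
        trans (⊛-zeroʳ P (λ ds → vQ (d ∷ ds) (s≤s z≤n)) ds)
              (sym (⊛-zeroʳ P' (λ ds → vQ' (d ∷ ds) (s≤s z≤n)) ds))
      right (suc b) vQ vQ' eQ le =
        ⊛-agree a b vP vP' (Vanishes-∂ d vQ) (Vanishes-∂ d vQ') eP (agree-∂ d eQ) ds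
                (ℕ.≤-pred (≡.subst (ℕ._≤ suc (length ds)) (+-suc a b) le))

    -- Degrees add under products: as P agrees with 0 from order a + 1 on,
    -- P ⊛ Q agrees with 0 ⊛ Q from order a + 1 + b on.
    ⊛-vanishes : ∀ a b {P Q} → Vanishes a P → Vanishes b Q → Vanishes (a ℕ.+ b) (P ⊛ Q)
    ⊛-vanishes a b {P} {Q} vP vQ ds lt =
      trans (⊛-agree (suc a) b (Vanishes-suc vP) (λ _ _ → refl) vQ vQ vP (λ _ _ → refl) ds lt)
            (⊛-zeroˡ Q (λ _ → refl) ds)
      where
      Vanishes-suc : ∀ {k P} → Vanishes k P → Vanishes (suc k) P
      Vanishes-suc v ds lt = v ds (<⇒≤ lt)

    HasDegree : ℕ → Poly K n → Set (c ⊔ ℓ)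
    HasDegree k p = (∀ x → Vanishes k (jet p x)) × (∀ x x' → jet p x ≈[≥ k ] jet p x')

    degree-con : ∀ a → HasDegree 0 (con a)
    degree-con a = vanish , (λ x x' ds _ → trans (jet-con a x ds) (sym (jet-con a x' ds)))
      where
      vanish : ∀ x → Vanishes 0 (jet (con a) x)
      vanish x (d ∷ ds) _ = jet-con a x (d ∷ ds)

    degree-var : ∀ i → HasDegree 1 (var i)
    degree-var i = vanish , agree
      where
      vanish : ∀ x → Vanishes 1 (jet (var i) x)
      vanish x (d ∷ e ∷ ds) _       = jet-con (δ K d i) x (e ∷ ds)
      vanish x (d ∷ [])     (s≤s ())
      agree : ∀ x x' → jet (var i) x ≈[≥ 1 ] jet (var i) x'
      agree x x' (d ∷ ds) _ = trans (jet-con (δ K d i) x ds) (sym (jet-con (δ K d i) x' ds))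

    degree-⊗ : ∀ a b {p q} → HasDegree a p → HasDegree b q → HasDegree (a ℕ.+ b) (p ⊗ q)
    degree-⊗ a b {p} {q} (vp , ep) (vq , eq) = vanish , agree
      where
      vanish : ∀ x → Vanishes (a ℕ.+ b) (jet (p ⊗ q) x)
      vanish x ds lt = trans (jet-⊗ p q x ds) (⊛-vanishes a b (vp x) (vq x) ds lt)
      agree : ∀ x x' → jet (p ⊗ q) x ≈[≥ a ℕ.+ b ] jet (p ⊗ q) x'
      agree x x' ds le = trans (jet-⊗ p q x ds)
        (trans (⊛-agree a b (vp x) (vp x') (vq x) (vq x') (ep x x') (eq x x') ds le) (sym (jet-⊗ p q x' ds)))

    degree-ΣP : ∀ {k m} (f : Fin m → Poly K n) → (∀ i → HasDegree k (f i)) → HasDegree k (ΣP K f)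
    degree-ΣP {k} {m} f deg = vanish , agree
      where
      vanish : ∀ x → Vanishes k (jet (ΣP K f) x)
      vanish x ds lt = trans (jet-ΣP f x ds) (trans (sum-cong (λ i → proj₁ (deg i) x ds lt)) (sum-zero {m}))
      agree : ∀ x x' → jet (ΣP K f) x ≈[≥ k ] jet (ΣP K f) x'
      agree x x' ds le = trans (jet-ΣP f x ds)
        (trans (sum-cong (λ i → proj₂ (deg i) x x' ds le)) (sym (jet-ΣP f x' ds)))

    degree-∂ : ∀ {k p} d → HasDegree (suc k) p → HasDegree k (∂ K d p)
    degree-∂ d (vp , ep) = (λ x → Vanishes-∂ d (vp x)) , (λ x x' → agree-∂ d (ep x x'))

    degree-quadForm : ∀ q → HasDegree 2 (quadForm K q)
    degree-quadForm q = degree-ΣP _ (λ a → degree-ΣP _ (λ b →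
      degree-⊗ 1 1 (degree-⊗ 0 1 (degree-con (q a b)) (degree-var a)) (degree-var b)))

    -- The chain rule for the linear substitution x_k ↦ Σ_l g_lk x_l used by
    -- the action: derivatives of the substituted polynomial at x are those of
    -- the original one at the image point y x, with each direction index
    -- transformed by g.

    module Pullback (g : Mat K n) where

      σ : Fin n → Poly K n
      σ k = ΣP K (λ l → con (g l k) ⊗ var l)

      y : (Fin n → Carrier) → Fin n → Carrier
      y x k = eval K (σ k) x

      -- transform every direction index of a jet by g; note that ∂ᴶ d (pull F)
      -- is definitionally g d ▷ (λ u → pull (∂ᴶ u F))
      pull : Jet → Jet
      pull F []       = F []
      pull F (d ∷ ds) = sum (λ u → g d u * pull (∂ᴶ u F) ds)

      pull-cong : ∀ {F G} → F ≈ᴶ G → pull F ≈ᴶ pull G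
      pull-cong e []       = e []
      pull-cong e (d ∷ ds) = sum-cong (λ u → *-congˡ (pull-cong (λ ds → e (u ∷ ds)) ds))

      pull-vanishes : ∀ k {F} → Vanishes k F → Vanishes k (pull F)
      pull-vanishes k {F} v (d ∷ ds) lt =
        trans (sum-cong (λ u → trans (*-congˡ (∂-vanishes k v ds lt u)) (zeroʳ (g d u)))) (sum-zero {n})
        where
        ∂-vanishes : ∀ k → Vanishes k F → ∀ ds → k ℕ.< suc (length ds) → ∀ u → pull (∂ᴶ u F) ds ≈ 0#
        ∂-vanishes zero    v []       _        u = v (u ∷ []) (s≤s z≤n)
        ∂-vanishes zero    v (e ∷ ds) _        u =
          pull-vanishes 0 (λ ds _ → v (u ∷ ds) (s≤s z≤n)) (e ∷ ds) (s≤s z≤n)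
        ∂-vanishes (suc k) v ds       (s≤s lt) u = pull-vanishes k (Vanishes-∂ u v) ds lt

      pull-const : ∀ a → pull (const a) ≈ᴶ const a
      pull-const a []       = refl
      pull-const a (d ∷ ds) = pull-vanishes 0 {const a} (λ { (_ ∷ _) _ → refl }) (d ∷ ds) (s≤s z≤n)

      pull-+ : ∀ F G → pull (F +ᴶ G) ≈ᴶ pull F +ᴶ pull G
      pull-+ F G []       = refl
      pull-+ F G (d ∷ ds) = begin
        sum (λ u → g d u * pull (∂ᴶ u F +ᴶ ∂ᴶ u G) ds)
          ≈⟨ sum-cong (λ u → *-congˡ (pull-+ (∂ᴶ u F) (∂ᴶ u G) ds)) ⟩
        sum (λ u → g d u * (pull (∂ᴶ u F) ds + pull (∂ᴶ u G) ds))
          ≈⟨ sum-cong (λ u → distribˡ (g d u) _ _) ⟩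
        sum (λ u → g d u * pull (∂ᴶ u F) ds + g d u * pull (∂ᴶ u G) ds)
          ≈⟨ ∑-distrib-+ (λ u → g d u * pull (∂ᴶ u F) ds) (λ u → g d u * pull (∂ᴶ u G) ds) ⟩
        pull F (d ∷ ds) + pull G (d ∷ ds) ∎
        where open ≈-Reasoning

      pull-neg : ∀ F → pull (-ᴶ F) ≈ᴶ -ᴶ pull F
      pull-neg F []       = refl
      pull-neg F (d ∷ ds) = begin
        sum (λ u → g d u * pull (-ᴶ ∂ᴶ u F) ds)   ≈⟨ sum-cong (λ u → *-congˡ (pull-neg (∂ᴶ u F) ds)) ⟩
        sum (λ u → g d u * - pull (∂ᴶ u F) ds)    ≈⟨ sum-cong (λ u → -‿distribʳ-* (g d u) _) ⟨
        sum (λ u → - (g d u * pull (∂ᴶ u F) ds))  ≈⟨ -‿sum (λ u → g d u * pull (∂ᴶ u F) ds) ⟨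
        - pull F (d ∷ ds)                         ∎
        where open ≈-Reasoning

      pull-▷ : ∀ {m} (α : Fin m → Carrier) (F : Fin m → Jet) → pull (α ▷ F) ≈ᴶ α ▷ (λ a → pull (F a))
      pull-▷ α F []       = refl
      pull-▷ α F (d ∷ ds) = begin
        sum (λ u → g d u * pull (α ▷ λ a → ∂ᴶ u (F a)) ds)
          ≈⟨ sum-cong (λ u → *-congˡ (pull-▷ α (λ a → ∂ᴶ u (F a)) ds)) ⟩
        sum (λ u → g d u * sum (λ a → α a * pull (∂ᴶ u (F a)) ds))
          ≈⟨ sum-comm-weighted (g d) α (λ u a → pull (∂ᴶ u (F a)) ds) ⟩
        sum (λ a → α a * pull (F a) (d ∷ ds)) ∎
        where open ≈-Reasoning

      pull-Σ : ∀ {m} (F : Fin m → Jet) → pull (ΣJ F) ≈ᴶ ΣJ (λ a → pull (F a))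
      pull-Σ F []       = refl
      pull-Σ F (d ∷ ds) = begin
        sum (λ u → g d u * pull (ΣJ λ a → ∂ᴶ u (F a)) ds)
          ≈⟨ sum-cong (λ u → *-congˡ (pull-Σ (λ a → ∂ᴶ u (F a)) ds)) ⟩
        sum (λ u → g d u * sum (λ a → pull (∂ᴶ u (F a)) ds))
          ≈⟨ sum-cong (λ u → *-distribˡ-sum (g d u) (λ a → pull (∂ᴶ u (F a)) ds)) ⟩
        sum (λ u → sum (λ a → g d u * pull (∂ᴶ u (F a)) ds))
          ≈⟨ ∑-comm (λ u a → g d u * pull (∂ᴶ u (F a)) ds) ⟩
        sum (λ a → pull (F a) (d ∷ ds)) ∎
        where open ≈-Reasoning

      pull-▷² : ∀ (α β : Fin n → Carrier) (F : Fin n → Fin n → Jet) →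
        pull (α ▷ λ a → β ▷ F a) ≈ᴶ α ▷ (λ a → β ▷ λ b → pull (F a b))
      pull-▷² α β F ds = trans (pull-▷ α (λ a → β ▷ F a) ds) (▷-cong α (λ a → pull-▷ β (F a)) ds)

      pull-▷³ : ∀ (α β γ : Fin n → Carrier) (F : Fin n → Fin n → Fin n → Jet) →
        pull (α ▷ λ a → β ▷ λ b → γ ▷ F a b) ≈ᴶ α ▷ (λ a → β ▷ λ b → γ ▷ λ c → pull (F a b c))
      pull-▷³ α β γ F ds =
        trans (pull-▷² α β (λ a b → γ ▷ F a b) ds) (▷-cong² α β (λ a b → pull-▷ γ (F a b)) ds)

      pull-⊛ : ∀ P Q → pull (P ⊛ Q) ≈ᴶ pull P ⊛ pull Q
      pull-⊛ P Q []       = refl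
      pull-⊛ P Q (d ∷ ds) = begin
        sum (λ u → g d u * pull (∂ᴶ u P ⊛ Q +ᴶ P ⊛ ∂ᴶ u Q) ds)
          ≈⟨ sum-cong (λ u → *-congˡ (trans (pull-+ (∂ᴶ u P ⊛ Q) (P ⊛ ∂ᴶ u Q) ds)
                (+-cong (pull-⊛ (∂ᴶ u P) Q ds) (pull-⊛ P (∂ᴶ u Q) ds)))) ⟩
        sum (λ u → g d u * (A u + B u))
          ≈⟨ sum-cong (λ u → distribˡ (g d u) (A u) (B u)) ⟩
        sum (λ u → g d u * A u + g d u * B u)
          ≈⟨ ∑-distrib-+ (λ u → g d u * A u) (λ u → g d u * B u) ⟩
        sum (λ u → g d u * A u) + sum (λ u → g d u * B u)
          ≈⟨ +-cong (⊛-▷ˡ (g d) (λ u → pull (∂ᴶ u P)) (pull Q) ds)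
                    (⊛-▷ʳ (pull P) (g d) (λ u → pull (∂ᴶ u Q)) ds) ⟨
        (∂ᴶ d (pull P) ⊛ pull Q) ds + (pull P ⊛ ∂ᴶ d (pull Q)) ds ∎
        where
        open ≈-Reasoning
        A B : Fin n → Carrier
        A u = (pull (∂ᴶ u P) ⊛ pull Q) ds
        B u = (pull P ⊛ pull (∂ᴶ u Q)) ds

      gᵀ : Mat K n
      gᵀ a b = g b a

      pull-transform : ∀ {k} F (R : Vec (Fin n) k) →
        pull F (toList R) ≈ transform (replicate k gᵀ) (λ R' → F (toList R')) R
      pull-transform F []      = refl
      pull-transform F (r ∷ R) = sum-cong (λ u → *-congˡ (pull-transform (∂ᴶ u F) R))

      chain-var : ∀ k x → jet (σ k) x ≈ᴶ pull (jet (var k) (y x))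
      chain-var k x ds = trans (jet-ΣP (λ l → con (g l k) ⊗ var l) x ds) (linear ds)
        where
        linear : ∀ ds → sum (λ l → jet (con (g l k) ⊗ var l) x ds) ≈ pull (jet (var k) (y x)) ds
        linear [] = sym (jet-ΣP (λ l → con (g l k) ⊗ var l) x [])
        linear (d ∷ []) = begin
          sum (λ l → jet (con (g l k) ⊗ var l) x (d ∷ []))
            ≈⟨ sum-cong (λ l → trans (jet-⊗ (con (g l k)) (var l) x (d ∷ []))
                                      (trans (⊛-constˡ (g l k) (jet (var l) x) (d ∷ [])) (*-comm _ _))) ⟩
          sum (λ l → δ K d l * g l k)  ≈⟨ sum-δ d (λ l → g l k) ⟩
          g d k                        ≈⟨ sum-δ k (g d) ⟨
          sum (λ u → δ K k u * g d u)  ≈⟨ sum-cong (λ u → trans (*-comm _ _) (*-congˡ (reflexive (δ-sym k u)))) ⟩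
          sum (λ u → g d u * δ K u k)  ∎
          where open ≈-Reasoning
        linear (d ∷ e ∷ ds) =
          trans (sum-cong vanish)
                (trans (sum-zero {n}) (sym (pull-vanishes 1 (proj₁ (degree-var k) (y x)) (d ∷ e ∷ ds) (s≤s (s≤s z≤n)))))
          where
          vanish : ∀ l → jet (con (g l k) ⊗ var l) x (d ∷ e ∷ ds) ≈ 0#
          vanish l = proj₁ (degree-⊗ 0 1 (degree-con (g l k)) (degree-var l)) x (d ∷ e ∷ ds) (s≤s (s≤s z≤n))

      T : Poly K n → Poly K n
      T = subst-vars K σ

      chain : ∀ p x → jet (T p) x ≈ᴶ pull (jet p (y x))
      chain (con a) x = begin
        jet (con a) x              ≈⟨ jet-con a x ⟩
        const a                    ≈⟨ pull-const a ⟨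
        pull (const a)             ≈⟨ pull-cong (jet-con a (y x)) ⟨
        pull (jet (con a) (y x))   ∎
        where open ≈ᴶ-Reasoning
      chain (var k) x = chain-var k x
      chain (p ⊕ q) x = begin
        jet (T p ⊕ T q) x                      ≈⟨ jet-⊕ (T p) (T q) x ⟩
        jet (T p) x +ᴶ jet (T q) x             ≈⟨ (λ ds → +-cong (chain p x ds) (chain q x ds)) ⟩
        pull (jet p (y x)) +ᴶ pull (jet q (y x)) ≈⟨ pull-+ (jet p (y x)) (jet q (y x)) ⟨
        pull (jet p (y x) +ᴶ jet q (y x))      ≈⟨ pull-cong (jet-⊕ p q (y x)) ⟨
        pull (jet (p ⊕ q) (y x))               ∎
        where open ≈ᴶ-Reasoning
      chain (p ⊗ q) x = begin
        jet (T p ⊗ T q) x                      ≈⟨ jet-⊗ (T p) (T q) x ⟩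
        jet (T p) x ⊛ jet (T q) x              ≈⟨ ⊛-cong (chain p x) (chain q x) ⟩
        pull (jet p (y x)) ⊛ pull (jet q (y x)) ≈⟨ pull-⊛ (jet p (y x)) (jet q (y x)) ⟨
        pull (jet p (y x) ⊛ jet q (y x))       ≈⟨ pull-cong (jet-⊗ p q (y x)) ⟨
        pull (jet (p ⊗ q) (y x))               ∎
        where open ≈ᴶ-Reasoning
      chain (⊝ p) x = begin
        jet (⊝ T p) x                          ≈⟨ jet-⊝ (T p) x ⟩
        -ᴶ jet (T p) x                         ≈⟨ (λ ds → -‿cong (chain p x ds)) ⟩
        -ᴶ pull (jet p (y x))                  ≈⟨ pull-neg (jet p (y x)) ⟨
        pull (-ᴶ jet p (y x))                  ≈⟨ pull-cong (jet-⊝ p (y x)) ⟨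
        pull (jet (⊝ p) (y x))                 ∎
        where open ≈ᴶ-Reasoning

    -- The polynomials M_ij and N_ijk of the paper.

    M-of : PolyMat K n → PolyMat K n
    M-of A i j = ΣP K λ r → ΣP K λ s → ∂ K s (A i r) ⊗ ∂ K r (A j s)

    N-of : PolyMat K n → Fin n → Fin n → Fin n → Poly K n
    N-of A i j k = ΣP K λ r → ∂ K r (M-of A i j) ⊗ A r k

    jet-M : ∀ A i j x →
      jet (M-of A i j) x ≈ᴶ ΣJ (λ r → ΣJ (λ s → ∂ᴶ s (jet (A i r) x) ⊛ ∂ᴶ r (jet (A j s) x)))
    jet-M A i j x ds =
      trans (jet-ΣP _ x ds) (sum-cong (λ r → trans (jet-ΣP _ x ds)
        (sum-cong (λ s → jet-⊗ (∂ K s (A i r)) (∂ K r (A j s)) x ds))))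

    jet-N : ∀ A i j k x → jet (N-of A i j k) x ≈ᴶ ΣJ (λ r → ∂ᴶ r (jet (M-of A i j) x) ⊛ jet (A r k) x)
    jet-N A i j k x ds =
      trans (jet-ΣP _ x ds) (sum-cong (λ r → jet-⊗ (∂ K r (M-of A i j)) (A r k) x ds))

    Quadratic : PolyMat K n → Set (c ⊔ ℓ)
    Quadratic A = ∀ a b → HasDegree 2 (A a b)

    degree-M : ∀ {A} → Quadratic A → ∀ i j → HasDegree 2 (M-of A i j)
    degree-M quad i j = degree-ΣP _ (λ r → degree-ΣP _ (λ s →
      degree-⊗ 1 1 (degree-∂ s (quad i r)) (degree-∂ r (quad j s))))

    degree-N : ∀ {A} → Quadratic A → ∀ i j k → HasDegree 3 (N-of A i j k)
    degree-N quad i j k = degree-ΣP _ (λ r → degree-⊗ 1 2 (degree-∂ r (degree-M quad i j)) (quad r k))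

    -- c₄ and c₆ (without their scalar prefactors) as full contractions of the
    -- mixed tensors ∂_R M_I and ∂_R N_I: I collects the matrix indices, R the
    -- directions of differentiation.

    c₄-sum : PolyMat K n → Poly K n
    c₄-sum A = ΣP K λ i → ΣP K λ j → ΣP K λ r → ΣP K λ s →
                 ∂ K s (∂ K r (M-of A i j)) ⊗ ∂ K j (∂ K i (M-of A r s))

    c₆-sum : PolyMat K n → Poly K n
    c₆-sum A = ΣP K λ i → ΣP K λ j → ΣP K λ k → ΣP K λ r → ΣP K λ s → ΣP K λ t →
                 ∂ K t (∂ K s (∂ K r (N-of A i j k))) ⊗ ∂ K k (∂ K j (∂ K i (N-of A r s t)))

    ∂²M : PolyMat K n → (Fin n → Carrier) → Vec (Fin n) 2 → Tensor n 2
    ∂²M A x (i ∷ j ∷ []) R = jet (M-of A i j) x (toList R)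

    ∂³N : PolyMat K n → (Fin n → Carrier) → Vec (Fin n) 3 → Tensor n 3
    ∂³N A x (i ∷ j ∷ k ∷ []) R = jet (N-of A i j k) x (toList R)

    eval-c₄-sum : ∀ A x → eval K (c₄-sum A) x ≈ ⟪ ∂²M A x ⟫
    eval-c₄-sum A x = trans (eval-ΣP² (λ i j → ΣP K λ r → ΣP K λ s → term i j r s) x)
                            (sum-cong (λ i → sum-cong (λ j → eval-ΣP² (term i j) x)))
      where
      term : Fin n → Fin n → Fin n → Fin n → Poly K n
      term i j r s = ∂ K s (∂ K r (M-of A i j)) ⊗ ∂ K j (∂ K i (M-of A r s))

    eval-c₆-sum : ∀ A x → eval K (c₆-sum A) x ≈ ⟪ ∂³N A x ⟫
    eval-c₆-sum A x =
      trans (eval-ΣP³ (λ i j k → ΣP K λ r → ΣP K λ s → ΣP K λ t → term i j k r s t))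
            (sum-cong (λ i → sum-cong (λ j → sum-cong (λ k → eval-ΣP³ (term i j k)))))
      where
      term : Fin n → Fin n → Fin n → Fin n → Fin n → Fin n → Poly K n
      term i j k r s t = ∂ K t (∂ K s (∂ K r (N-of A i j k))) ⊗ ∂ K k (∂ K j (∂ K i (N-of A r s t)))
      eval-ΣP³ : ∀ (f : Fin n → Fin n → Fin n → Poly K n) →
        eval K (ΣP K λ i → ΣP K λ j → ΣP K λ k → f i j k) x ≈
        sum (λ i → sum (λ j → sum (λ k → eval K (f i j k) x)))
      eval-ΣP³ f = trans (eval-ΣP² (λ i j → ΣP K (f i j)) x) (sum-cong (λ i → sum-cong (λ j → jet-ΣP (f i j) x [])))

    ∂²M-constant : ∀ {A} → Quadratic A → ∀ x x' I R → ∂²M A x I R ≈ ∂²M A x' I R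
    ∂²M-constant quad x x' (i ∷ j ∷ []) R =
      proj₂ (degree-M quad i j) x x' (toList R) (≤-reflexive (≡.sym (length-toList R)))

    ∂³N-constant : ∀ {A} → Quadratic A → ∀ x x' I R → ∂³N A x I R ≈ ∂³N A x' I R
    ∂³N-constant quad x x' (i ∷ j ∷ k ∷ []) R =
      proj₂ (degree-N quad i j k) x x' (toList R) (≤-reflexive (≡.sym (length-toList R)))

    -- Under g ⋆ – the matrix
    -- indices of Ω are transformed by h and, by the chain rule, the
    -- directions of differentiation by g.  These two kinds of index are dual,
    -- so the contractions defining M and N preserve the transformation law.

    module Covariance (g h : Mat K n) (hg : ∀ a b → _·_ K h g a b ≈ δ K a b) where
      open Pullback g

      h-gᵀ-dual : Dual h gᵀ
      h-gᵀ-dual a b = trans (reflexive (≡.sym (ΣK≡sum (λ k → h a k * g k b)))) (hg a b)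

      gᵀ-h-dual : Dual gᵀ h
      gᵀ-h-dual = Dual-sym h-gᵀ-dual

      hᶜ : Fin n → Fin n → Carrier
      hᶜ i a = h a i

      Tr₂ : (Fin n → Fin n → Jet) → Fin n → Fin n → Jet
      Tr₂ W i j = hᶜ i ▷ λ a → hᶜ j ▷ λ b → W a b

      Tr₃ : (Fin n → Fin n → Fin n → Jet) → Fin n → Fin n → Fin n → Jet
      Tr₃ V i j k = hᶜ i ▷ λ a → hᶜ j ▷ λ b → hᶜ k ▷ λ c → V a b c

      Covariant : PolyMat K n → PolyMat K n → Set (c ⊔ ℓ)
      Covariant A B = ∀ x i j → jet (A i j) x ≈ᴶ pull (Tr₂ (λ a b → jet (B a b) (y x)) i j)

      ⋆-covariant : (pf : IsInverse K g h) (Ω : PolyMat K n) → Covariant (_⋆_ K (g , h , pf) Ω) Ω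
      ⋆-covariant pf Ω x i j = begin
        jet (_⋆_ K (g , h , pf) Ω i j) x
          ≈⟨ (λ ds → trans (jet-ΣP (λ a → ΣP K (term a)) x ds) (sum-cong (λ a → jet-ΣP (term a) x ds))) ⟩
        ΣJ (λ a → ΣJ (λ b → jet (term a b) x))
          ≈⟨ ΣJ-cong (λ a → ΣJ-cong (λ b → entry a b)) ⟩
        ΣJ (λ a → ΣJ (λ b → h a i ·ᴶ (h b j ·ᴶ pull (W a b))))
          ≈⟨ (λ ds → sum-cong (λ a → sym (*-distribˡ-sum (h a i) (λ b → h b j * pull (W a b) ds)))) ⟩
        hᶜ i ▷ (λ a → hᶜ j ▷ λ b → pull (W a b))
          ≈⟨ pull-▷² (hᶜ i) (hᶜ j) W ⟨
        pull (Tr₂ W i j) ∎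
        where
        open ≈ᴶ-Reasoning
        W : Fin n → Fin n → Jet
        W a b = jet (Ω a b) (y x)
        term : Fin n → Fin n → Poly K n
        term a b = con (h a i) ⊗ T (Ω a b) ⊗ con (h b j)
        entry : ∀ a b → jet (term a b) x ≈ᴶ h a i ·ᴶ (h b j ·ᴶ pull (W a b))
        entry a b = begin
          jet (con (h a i) ⊗ T (Ω a b) ⊗ con (h b j)) x
            ≈⟨ jet-⊗ (con (h a i) ⊗ T (Ω a b)) (con (h b j)) x ⟩
          jet (con (h a i) ⊗ T (Ω a b)) x ⊛ jet (con (h b j)) x
            ≈⟨ ⊛-cong (jet-⊗ (con (h a i)) (T (Ω a b)) x) (jet-con (h b j) x) ⟩
          (jet (con (h a i)) x ⊛ jet (T (Ω a b)) x) ⊛ const (h b j)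
            ≈⟨ ⊛-constʳ (h b j) _ ⟩
          h b j ·ᴶ (jet (con (h a i)) x ⊛ jet (T (Ω a b)) x)
            ≈⟨ (λ ds → *-congˡ (⊛-cong (jet-con (h a i) x) (chain (Ω a b) x) ds)) ⟩
          h b j ·ᴶ (const (h a i) ⊛ pull (W a b))
            ≈⟨ (λ ds → *-congˡ (⊛-constˡ (h a i) (pull (W a b)) ds)) ⟩
          h b j ·ᴶ (h a i ·ᴶ pull (W a b))
            ≈⟨ (λ ds → *-lcomm (h b j) (h a i) _) ⟩
          h a i ·ᴶ (h b j ·ᴶ pull (W a b)) ∎

      module _ {A B : PolyMat K n} (cov : Covariant A B) (x : Fin n → Carrier) where

        private
          W : Fin n → Fin n → Jet
          W a b = jet (B a b) (y x)

          P : Fin n → Fin n → Fin n → Jet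
          P u a b = pull (∂ᴶ u (W a b))

          U : Fin n → Fin n → Jet
          U a c = jet (M-of B a c) (y x)

        ∂-covariant : ∀ i r s →
          ∂ᴶ s (jet (A i r) x) ≈ᴶ g s ▷ (λ u → hᶜ r ▷ λ b → hᶜ i ▷ λ a → P u a b)
        ∂-covariant i r s = begin
          ∂ᴶ s (jet (A i r) x)
            ≈⟨ (λ ds → cov x i r (s ∷ ds)) ⟩
          g s ▷ (λ u → pull (hᶜ i ▷ λ a → hᶜ r ▷ λ b → ∂ᴶ u (W a b)))
            ≈⟨ ▷-cong (g s) (λ u → pull-▷² (hᶜ i) (hᶜ r) (λ a b → ∂ᴶ u (W a b))) ⟩
          g s ▷ (λ u → hᶜ i ▷ λ a → hᶜ r ▷ λ b → P u a b)
            ≈⟨ ▷-cong (g s) (λ u → ▷-comm (hᶜ i) (hᶜ r) (P u)) ⟩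
          g s ▷ (λ u → hᶜ r ▷ λ b → hᶜ i ▷ λ a → P u a b) ∎
          where open ≈ᴶ-Reasoning

        M-pulled : ∀ a c → ΣJ (λ u → ΣJ (λ b → P u a b ⊛ P b c u)) ≈ᴶ pull (jet (M-of B a c) (y x))
        M-pulled a c = begin
          ΣJ (λ u → ΣJ (λ b → pull (∂ᴶ u (W a b)) ⊛ pull (∂ᴶ b (W c u))))
            ≈⟨ ΣJ-cong (λ u → ΣJ-cong (λ b → pull-⊛ (∂ᴶ u (W a b)) (∂ᴶ b (W c u)))) ⟨
          ΣJ (λ u → ΣJ (λ b → pull (∂ᴶ u (W a b) ⊛ ∂ᴶ b (W c u))))
            ≈⟨ ΣJ-cong (λ u → pull-Σ (λ b → ∂ᴶ u (W a b) ⊛ ∂ᴶ b (W c u))) ⟨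
          ΣJ (λ u → pull (ΣJ (λ b → ∂ᴶ u (W a b) ⊛ ∂ᴶ b (W c u))))
            ≈⟨ pull-Σ (λ u → ΣJ (λ b → ∂ᴶ u (W a b) ⊛ ∂ᴶ b (W c u))) ⟨
          pull (ΣJ (λ u → ΣJ (λ b → ∂ᴶ u (W a b) ⊛ ∂ᴶ b (W c u))))
            ≈⟨ pull-cong (ΣJ-comm (λ u b → ∂ᴶ u (W a b) ⊛ ∂ᴶ b (W c u))) ⟩
          pull (ΣJ (λ b → ΣJ (λ u → ∂ᴶ u (W a b) ⊛ ∂ᴶ b (W c u))))
            ≈⟨ pull-cong (jet-M B a c (y x)) ⟨
          pull (jet (M-of B a c) (y x)) ∎
          where open ≈ᴶ-Reasoning

        -- M-of A is again covariant: as a function of x this is Covariant (M-of A) (M-of B);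
        -- the two contractions in M pair a direction index with a matrix index
        M-covariant : ∀ i j → jet (M-of A i j) x ≈ᴶ pull (Tr₂ (λ a c → jet (M-of B a c) (y x)) i j)
        M-covariant i j = begin
          jet (M-of A i j) x
            ≈⟨ jet-M A i j x ⟩
          ΣJ (λ r → ΣJ (λ s → ∂ᴶ s (jet (A i r) x) ⊛ ∂ᴶ r (jet (A j s) x)))
            ≈⟨ ΣJ-cong (λ r → ΣJ-cong (λ s → ⊛-cong (∂-covariant i r s) (second r s))) ⟩
          ΣJ (λ r → ΣJ (λ s → (g s ▷ λ u → hᶜ r ▷ X u) ⊛ (hᶜ s ▷ λ d → g r ▷ λ v → Y v d)))
            ≈⟨ ΣJ-cong (λ r → contractᴶ gᵀ-h-dual (λ u → hᶜ r ▷ X u) (λ d → g r ▷ λ v → Y v d)) ⟩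
          ΣJ (λ r → ΣJ (λ u → (hᶜ r ▷ X u) ⊛ (g r ▷ λ v → Y v u)))
            ≈⟨ ΣJ-comm (λ r u → (hᶜ r ▷ X u) ⊛ (g r ▷ λ v → Y v u)) ⟩
          ΣJ (λ u → ΣJ (λ r → (hᶜ r ▷ X u) ⊛ (g r ▷ λ v → Y v u)))
            ≈⟨ ΣJ-cong (λ u → contractᴶ h-gᵀ-dual (X u) (λ v → Y v u)) ⟩
          ΣJ (λ u → ΣJ (λ b → X u b ⊛ Y b u))
            ≈⟨ ΣJ-cong (λ u → ΣJ-cong (λ b → ⊛-expand (hᶜ i) (λ a → P u a b) (hᶜ j) (λ c → P b c u))) ⟩
          ΣJ (λ u → ΣJ (λ b → hᶜ i ▷ λ a → hᶜ j ▷ λ c → P u a b ⊛ P b c u))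
            ≈⟨ ΣJ-cong (λ u → ΣJ-▷² (hᶜ i) (hᶜ j) (λ b a c → P u a b ⊛ P b c u)) ⟩
          ΣJ (λ u → hᶜ i ▷ λ a → hᶜ j ▷ λ c → ΣJ (λ b → P u a b ⊛ P b c u))
            ≈⟨ ΣJ-▷² (hᶜ i) (hᶜ j) (λ u a c → ΣJ (λ b → P u a b ⊛ P b c u)) ⟩
          hᶜ i ▷ (λ a → hᶜ j ▷ λ c → ΣJ (λ u → ΣJ (λ b → P u a b ⊛ P b c u)))
            ≈⟨ ▷-cong² (hᶜ i) (hᶜ j) M-pulled ⟩
          hᶜ i ▷ (λ a → hᶜ j ▷ λ c → pull (jet (M-of B a c) (y x)))
            ≈⟨ pull-▷² (hᶜ i) (hᶜ j) (λ a c → jet (M-of B a c) (y x)) ⟨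
          pull (Tr₂ (λ a c → jet (M-of B a c) (y x)) i j) ∎
          where
          open ≈ᴶ-Reasoning
          X Y : Fin n → Fin n → Jet
          X u b = hᶜ i ▷ λ a → P u a b
          Y v d = hᶜ j ▷ λ c → P v c d
          second : ∀ r s → ∂ᴶ r (jet (A j s) x) ≈ᴶ hᶜ s ▷ (λ d → g r ▷ λ v → Y v d)
          second r s = begin
            ∂ᴶ r (jet (A j s) x)               ≈⟨ ∂-covariant j s r ⟩
            g r ▷ (λ v → hᶜ s ▷ λ d → Y v d)   ≈⟨ ▷-comm (g r) (hᶜ s) Y ⟩
            hᶜ s ▷ (λ d → g r ▷ λ v → Y v d)   ∎

        N-pulled : ∀ a c f → ΣJ (λ u → pull (∂ᴶ u (U a c)) ⊛ pull (W u f)) ≈ᴶ pull (jet (N-of B a c f) (y x))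
        N-pulled a c f = begin
          ΣJ (λ u → pull (∂ᴶ u (U a c)) ⊛ pull (W u f))
            ≈⟨ ΣJ-cong (λ u → pull-⊛ (∂ᴶ u (U a c)) (W u f)) ⟨
          ΣJ (λ u → pull (∂ᴶ u (U a c) ⊛ W u f))
            ≈⟨ pull-Σ (λ u → ∂ᴶ u (U a c) ⊛ W u f) ⟨
          pull (ΣJ (λ u → ∂ᴶ u (U a c) ⊛ W u f))
            ≈⟨ pull-cong (jet-N B a c f (y x)) ⟨
          pull (jet (N-of B a c f) (y x)) ∎
          where open ≈ᴶ-Reasoning

        N-covariant : ∀ i j k →
          jet (N-of A i j k) x ≈ᴶ pull (Tr₃ (λ a c f → jet (N-of B a c f) (y x)) i j k)
        N-covariant i j k = begin
          jet (N-of A i j k) x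
            ≈⟨ jet-N A i j k x ⟩
          ΣJ (λ r → ∂ᴶ r (jet (M-of A i j) x) ⊛ jet (A r k) x)
            ≈⟨ ΣJ-cong (λ r → ⊛-cong (λ ds → M-covariant i j (r ∷ ds))
                                     (λ ds → trans (cov x r k ds) (pull-▷² (hᶜ r) (hᶜ k) W ds))) ⟩
          ΣJ (λ r → (g r ▷ Z) ⊛ (hᶜ r ▷ λ e → hᶜ k ▷ λ f → pull (W e f)))
            ≈⟨ contractᴶ gᵀ-h-dual Z (λ e → hᶜ k ▷ λ f → pull (W e f)) ⟩
          ΣJ (λ u → Z u ⊛ (hᶜ k ▷ λ f → pull (W u f)))
            ≈⟨ ΣJ-cong (λ u → expand u) ⟩
          ΣJ (λ u → hᶜ i ▷ λ a → hᶜ j ▷ λ c → hᶜ k ▷ λ f → pull (∂ᴶ u (U a c)) ⊛ pull (W u f))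
            ≈⟨ ΣJ-▷³ (hᶜ i) (hᶜ j) (hᶜ k) (λ u a c f → pull (∂ᴶ u (U a c)) ⊛ pull (W u f)) ⟩
          hᶜ i ▷ (λ a → hᶜ j ▷ λ c → hᶜ k ▷ λ f → ΣJ (λ u → pull (∂ᴶ u (U a c)) ⊛ pull (W u f)))
            ≈⟨ ▷-cong² (hᶜ i) (hᶜ j) (λ a c → ▷-cong (hᶜ k) (N-pulled a c)) ⟩
          hᶜ i ▷ (λ a → hᶜ j ▷ λ c → hᶜ k ▷ λ f → pull (jet (N-of B a c f) (y x)))
            ≈⟨ pull-▷³ (hᶜ i) (hᶜ j) (hᶜ k) (λ a c f → jet (N-of B a c f) (y x)) ⟨
          pull (Tr₃ (λ a c f → jet (N-of B a c f) (y x)) i j k) ∎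
          where
          open ≈ᴶ-Reasoning
          Z : Fin n → Jet
          Z u = pull (∂ᴶ u (Tr₂ U i j))
          expand : ∀ u → Z u ⊛ (hᶜ k ▷ λ f → pull (W u f)) ≈ᴶ
                   hᶜ i ▷ (λ a → hᶜ j ▷ λ c → hᶜ k ▷ λ f → pull (∂ᴶ u (U a c)) ⊛ pull (W u f))
          expand u = begin
            Z u ⊛ (hᶜ k ▷ λ f → pull (W u f))
              ≈⟨ ⊛-cong (pull-▷² (hᶜ i) (hᶜ j) (λ a c → ∂ᴶ u (U a c))) (λ _ → refl) ⟩
            (hᶜ i ▷ λ a → hᶜ j ▷ λ c → pull (∂ᴶ u (U a c))) ⊛ (hᶜ k ▷ λ f → pull (W u f))
              ≈⟨ ⊛-▷ˡ (hᶜ i) (λ a → hᶜ j ▷ λ c → pull (∂ᴶ u (U a c))) _ ⟩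
            hᶜ i ▷ (λ a → (hᶜ j ▷ λ c → pull (∂ᴶ u (U a c))) ⊛ (hᶜ k ▷ λ f → pull (W u f)))
              ≈⟨ ▷-cong (hᶜ i) (λ a →
                   ⊛-expand (hᶜ j) (λ c → pull (∂ᴶ u (U a c))) (hᶜ k) (λ f → pull (W u f))) ⟩
            hᶜ i ▷ (λ a → hᶜ j ▷ λ c → hᶜ k ▷ λ f → pull (∂ᴶ u (U a c)) ⊛ pull (W u f)) ∎

      ∂²M-covariant : ∀ {A B} → Covariant A B → ∀ x I R →
        ∂²M A x I R ≈ mixed-transform (replicate 2 h) (replicate 2 gᵀ) (∂²M B (y x)) I R
      ∂²M-covariant {B = B} cov x (i ∷ j ∷ []) R =
        trans (M-covariant cov x i j (toList R))
              (pull-transform (Tr₂ (λ a c → jet (M-of B a c) (y x)) i j) R)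

      ∂³N-covariant : ∀ {A B} → Covariant A B → ∀ x I R →
        ∂³N A x I R ≈ mixed-transform (replicate 3 h) (replicate 3 gᵀ) (∂³N B (y x)) I R
      ∂³N-covariant {B = B} cov x (i ∷ j ∷ k ∷ []) R =
        trans (N-covariant cov x i j k (toList R))
              (pull-transform (Tr₃ (λ a c f → jet (N-of B a c f) (y x)) i j k) R)

      c₄-sum-invariant : (pf : IsInverse K g h) (Ω : PolyMat K n) → Quadratic Ω → ∀ x →
        eval K (c₄-sum (_⋆_ K (g , h , pf) Ω)) x ≈ eval K (c₄-sum Ω) x
      c₄-sum-invariant pf Ω quad x = begin
        eval K (c₄-sum Ω') x   ≈⟨ eval-c₄-sum Ω' x ⟩
        ⟪ ∂²M Ω' x ⟫          ≈⟨ ⟪⟫-cong (∂²M-covariant (⋆-covariant pf Ω) x) ⟩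
        ⟪ mixed-transform (replicate 2 h) (replicate 2 gᵀ) (∂²M Ω (y x)) ⟫
                               ≈⟨ ⟪⟫-invariant (replicate-dual 2 h-gᵀ-dual) (∂²M Ω (y x)) ⟩
        ⟪ ∂²M Ω (y x) ⟫       ≈⟨ ⟪⟫-cong (∂²M-constant quad (y x) x) ⟩
        ⟪ ∂²M Ω x ⟫           ≈⟨ eval-c₄-sum Ω x ⟨
        eval K (c₄-sum Ω) x    ∎
        where
        open ≈-Reasoning
        Ω' : PolyMat K n
        Ω' = _⋆_ K (g , h , pf) Ω

      c₆-sum-invariant : (pf : IsInverse K g h) (Ω : PolyMat K n) → Quadratic Ω → ∀ x →
        eval K (c₆-sum (_⋆_ K (g , h , pf) Ω)) x ≈ eval K (c₆-sum Ω) x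
      c₆-sum-invariant pf Ω quad x = begin
        eval K (c₆-sum Ω') x   ≈⟨ eval-c₆-sum Ω' x ⟩
        ⟪ ∂³N Ω' x ⟫          ≈⟨ ⟪⟫-cong (∂³N-covariant (⋆-covariant pf Ω) x) ⟩
        ⟪ mixed-transform (replicate 3 h) (replicate 3 gᵀ) (∂³N Ω (y x)) ⟫
                               ≈⟨ ⟪⟫-invariant (replicate-dual 3 h-gᵀ-dual) (∂³N Ω (y x)) ⟩
        ⟪ ∂³N Ω (y x) ⟫       ≈⟨ ⟪⟫-cong (∂³N-constant quad (y x) x) ⟩
        ⟪ ∂³N Ω x ⟫           ≈⟨ eval-c₆-sum Ω x ⟨
        eval K (c₆-sum Ω) x    ∎
        where
        open ≈-Reasoning
        Ω' : PolyMat K n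
        Ω' = _⋆_ K (g , h , pf) Ω

lemma2p2 : {c ℓ : Level} (K : Field c ℓ) (char0 : CharZero K)
           (n : ℕ) (n≥3 : 3 ≤ n)
           (Q : QCoeffs K n) → IsAlternating K Q →
           (g : GL K n) →
           (_≐_ K (c₄ K char0 n≥3 (_⋆_ K g (Ωof K Q))) (c₄ K char0 n≥3 (Ωof K Q)))
           × (_≐_ K (c₆ K char0 n≥3 (_⋆_ K g (Ωof K Q))) (c₆ K char0 n≥3 (Ωof K Q)))
lemma2p2 K char0 n n≥3 Q _ (g , h , pf) =
  (λ x → *-congˡ (c₄-sum-invariant pf (Ωof K Q) quadratic x)) ,
  (λ x → *-congˡ (c₆-sum-invariant pf (Ωof K Q) quadratic x))
  where
  open Field K using (*-congˡ)
  open Invariance K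
  open Jets n
  open Covariance g h (proj₂ pf)
  quadratic : Quadratic (Ωof K Q)
  quadratic a b = degree-quadForm (Q a b)
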